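{- For any $\ell\in\mathbb{N}$, there exists an $\ell$-pseudo-majority $P\in\mathbb{R}[x_1,\ldots,x_\ell]$ of degree $\ell$ and weight $2^{O(\ell)}$.
   Context: The weight $w(P)$ of a polynomial $P$ is the sum of the absolute values of its coefficients. For $S\subseteq[\ell]$ and $b\in\{0,1\}$, $P|_{S\mapsto b}$ denotes the polynomial obtained from $P$ by setting every variable $x_i$, $i\in S$, to $b$. A polynomial $P\in\mathbb{R}[x_1,\ldots,x_\ell]$ is an $\ell$-pseudo-majority if, with $r$ the least integer greater than $\ell/2$, for every $S\subseteq[\ell]$ with $|S|=r$ and every $b\in\{0,1\}$, the polynomial $P|_{S\mapsto b}$ is (formally) the constant polynomial $b$. -}

module Defs where

open import Data.Bool using (Bool; true; false; if_then_else_)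
open import Data.Nat as ℕ using (ℕ; zero; suc; _/_)
open import Data.Rational as ℚ using (ℚ; 0ℚ; 1ℚ; ∣_∣)
open import Data.Vec using (Vec; []; _∷_)
open import Data.Vec.Properties using (≡-dec)
open import Data.List using (List; []; _∷_; map)
open import Data.List.Relation.Unary.Unique.Propositional using (Unique)
open import Data.List.Relation.Unary.Any using (Any)
open import Data.List.Relation.Unary.All using (All)
open import Data.Fin.Subset using (Subset; inside; outside) renaming (∣_∣ to #_)
open import Data.Product using (_×_; _,_; proj₁; proj₂)
open import Relation.Nullary using (¬_; yes; no)
open import Relation.Binary.PropositionalEquality using (_≡_)

Monomial : ℕ → Set
Monomial ℓ = Vec ℕ ℓ

Term : ℕ → Set
Term ℓ = ℚ × Monomial ℓ

Poly : ℕ → Set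
Poly ℓ = List (Term ℓ)

NormalForm : ∀ {ℓ} → Poly ℓ → Set
NormalForm P = Unique (map proj₂ P)

coeff : ∀ {ℓ} → Poly ℓ → Monomial ℓ → ℚ
coeff [] m = 0ℚ
coeff ((c , e) ∷ P) m with ≡-dec ℕ._≟_ e m
... | yes _ = c ℚ.+ coeff P m
... | no  _ = coeff P m

totalDeg : ∀ {ℓ} → Monomial ℓ → ℕ
totalDeg [] = 0
totalDeg (e ∷ m) = e ℕ.+ totalDeg m

isZeroMon : ∀ {ℓ} → Monomial ℓ → Bool
isZeroMon [] = true
isZeroMon (zero ∷ m) = isZeroMon m
isZeroMon (suc _ ∷ m) = false

-- Setting x_i := 1 for i ∈ S: zero out the exponents in S.
zeroOut : ∀ {ℓ} → Subset ℓ → Monomial ℓ → Monomial ℓ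
zeroOut [] [] = []
zeroOut (inside ∷ S) (e ∷ m) = 0 ∷ zeroOut S m
zeroOut (outside ∷ S) (e ∷ m) = e ∷ zeroOut S m

-- Setting x_i := 0 for i ∈ S kills the monomial iff some i ∈ S has positive exponent.
killed : ∀ {ℓ} → Subset ℓ → Monomial ℓ → Bool
killed [] [] = false
killed (inside ∷ S) (suc _ ∷ m) = true
killed (inside ∷ S) (zero ∷ m) = killed S m
killed (outside ∷ S) (e ∷ m) = killed S m

restrictTerm : ∀ {ℓ} → Subset ℓ → Bool → Term ℓ → Term ℓ
restrictTerm S true  (c , m) = c , zeroOut S m
restrictTerm S false (c , m) = (if killed S m then 0ℚ else c) , m

restrict : ∀ {ℓ} → Poly ℓ → Subset ℓ → Bool → Poly ℓ
restrict P S b = map (restrictTerm S b) P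

boolℚ : Bool → ℚ
boolℚ true = 1ℚ
boolℚ false = 0ℚ

IsConstant : ∀ {ℓ} → Poly ℓ → ℚ → Set
IsConstant P q = ∀ m → coeff P m ≡ (if isZeroMon m then q else 0ℚ)

-- ℓ-pseudo-majority, r = ⌊ℓ/2⌋ + 1 = least integer > ℓ/2
PseudoMajority : (ℓ : ℕ) → Poly ℓ → Set
PseudoMajority ℓ P =
  ∀ (S : Subset ℓ) → # S ≡ suc (ℓ / 2) → ∀ (b : Bool) → IsConstant (restrict P S b) (boolℚ b)

weight : ∀ {ℓ} → Poly ℓ → ℚ
weight [] = 0ℚ
weight ((c , _) ∷ P) = ∣ c ∣ ℚ.+ weight P

HasDegree : ∀ {ℓ} → Poly ℓ → ℕ → Set
HasDegree P d =
  Any (λ t → (¬ proj₁ t ≡ 0ℚ) × totalDeg (proj₂ t) ≡ d) P ×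
  All (λ t → ¬ proj₁ t ≡ 0ℚ → totalDeg (proj₂ t) ℕ.≤ d) P

module Submission where

-- The pseudo-majority is the threshold polynomial Thr(ℓ,k), the multilinear
-- extension of [x₁+⋯+x_ℓ ≥ k], for k = ⌈ℓ/2⌉.  It satisfies
--   Thr(ℓ+1,k+1) = Thr(ℓ,k+1) + x₁·(Thr(ℓ,k) − Thr(ℓ,k+1)),
-- so we represent multilinear polynomials as binary trees (`node p q` is
-- p + x₁·q) and read off every needed property by induction along this
-- recursion:
--   * setting a set S of ≥ k variables to 1 formally yields the constant 1,
--     and setting a set of > ℓ−k variables to 0 yields the constant 0; for
--     |S| = ⌊ℓ/2⌋+1 both conditions hold, so Thr(ℓ,⌈ℓ/2⌉) is a pseudo-majority;
--   * the coefficient of x₁⋯x_ℓ in Thr(ℓ,k) is nonzero for 1 ≤ k ≤ ℓ, since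
--     the recursion makes its sign alternate and its modulus at least 1;
--   * the weight at most triples per variable, so it is at most 4^ℓ = 2^(2ℓ).

open import Defs
open import Data.Nat using (ℕ; _*_; _^_)
open import Data.Integer using (+_)
open import Data.Rational using (_≤_; _/_)
open import Data.Product using (Σ; _×_; ∃)

open import Data.Bool using (Bool; true; false; not; if_then_else_)
open import Data.Empty using (⊥-elim)
open import Data.Fin.Subset using (Subset; inside; outside) renaming (∣_∣ to #_)
import Data.Integer as ℤ
import Data.Integer.Properties as ℤₚ
open import Data.List using ([]; _∷_; map; _++_)
import Data.List.Properties as Listₚ
open import Data.List.Membership.Propositional using (_∈_)
open import Data.List.Membership.Propositional.Properties using (∈-map⁻)
open import Data.List.Relation.Unary.All as All using (All)
import Data.List.Relation.Unary.All.Properties as Allₚ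
open import Data.List.Relation.Unary.Any as Any using (Any)
import Data.List.Relation.Unary.Any.Properties as Anyₚ
import Data.List.Relation.Unary.Unique.Propositional as Unique
import Data.List.Relation.Unary.Unique.Propositional.Properties as Uniqueₚ
open import Data.Nat as ℕ using (zero; suc; z≤n; s≤s; ⌊_/2⌋; ⌈_/2⌉)
import Data.Nat.Coprimality as ℕ-Coprime
import Data.Nat.DivMod as ℕ-DivMod
import Data.Nat.Properties as ℕₚ
open import Data.Product using (_,_; proj₁; proj₂)
open import Data.Rational as ℚ using (ℚ; 0ℚ; 1ℚ; _+_; _-_; -_; ∣_∣)
import Data.Rational.Properties as ℚₚ
open import Data.Rational.Solver using (module +-*-Solver)
open import Data.Unit using (tt)
open import Data.Vec using ([]; _∷_)
open import Data.Vec.Properties using (≡-dec; ∷-injectiveˡ; ∷-injectiveʳ)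
open import Function.Base using (_∘_)
open import Relation.Nullary using (¬_; Dec; yes; no)
open import Relation.Nullary.Decidable using (toWitness; toWitnessFalse)
open import Relation.Binary.PropositionalEquality

open +-*-Solver using (solve; _:+_; _:-_; _:=_)

-- Multilinear polynomials in x₁,…,x_ℓ as binary trees: `node p q` stands
-- for p + x₁·q, where p and q are polynomials in x₂,…,x_ℓ.
data Multilinear : ℕ → Set where
  leaf : ℚ → Multilinear 0
  node : ∀ {ℓ} → Multilinear ℓ → Multilinear ℓ → Multilinear (suc ℓ)

zeroML : ∀ ℓ → Multilinear ℓ
zeroML zero    = leaf 0ℚ
zeroML (suc ℓ) = node (zeroML ℓ) (zeroML ℓ)

_⊖_ : ∀ {ℓ} → Multilinear ℓ → Multilinear ℓ → Multilinear ℓ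
leaf a     ⊖ leaf b     = leaf (a - b)
node p₀ p₁ ⊖ node q₀ q₁ = node (p₀ ⊖ q₀) (p₁ ⊖ q₁)

-- The threshold polynomial Thr(ℓ,k): the multilinear extension of the
-- Boolean function [x₁+⋯+x_ℓ ≥ k], by conditioning on x₁.
threshold : (ℓ k : ℕ) → Multilinear ℓ
threshold zero    zero    = leaf 1ℚ
threshold zero    (suc k) = leaf 0ℚ
threshold (suc ℓ) zero    = node (threshold ℓ zero) (zeroML ℓ)
threshold (suc ℓ) (suc k) =
  node (threshold ℓ (suc k)) (threshold ℓ k ⊖ threshold ℓ (suc k))

consExp : ∀ {ℓ} → ℕ → Term ℓ → Term (suc ℓ)
consExp e (c , m) = c , e ∷ m

terms : ∀ {ℓ} → Multilinear ℓ → Poly ℓ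
terms (leaf c)   = (c , []) ∷ []
terms (node p q) = map (consExp 0) (terms p) ++ map (consExp 1) (terms q)

coeff-hit : ∀ {ℓ} c {e m : Monomial ℓ} (P : Poly ℓ) → e ≡ m →
            coeff ((c , e) ∷ P) m ≡ c + coeff P m
coeff-hit c {e} {m} P e≡m with ≡-dec ℕ._≟_ e m
... | yes _   = refl
... | no  e≢m = ⊥-elim (e≢m e≡m)

coeff-miss : ∀ {ℓ} c {e m : Monomial ℓ} (P : Poly ℓ) → ¬ e ≡ m →
             coeff ((c , e) ∷ P) m ≡ coeff P m
coeff-miss c {e} {m} P e≢m with ≡-dec ℕ._≟_ e m
... | yes e≡m = ⊥-elim (e≢m e≡m)
... | no  _   = refl

coeff-++ : ∀ {ℓ} (P Q : Poly ℓ) m → coeff (P ++ Q) m ≡ coeff P m + coeff Q m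
coeff-++ [] Q m = sym (ℚₚ.+-identityˡ _)
coeff-++ ((c , e) ∷ P) Q m with ≡-dec ℕ._≟_ e m
... | yes _ = trans (cong (λ x → c + x) (coeff-++ P Q m)) (sym (ℚₚ.+-assoc c _ _))
... | no  _ = coeff-++ P Q m

coeff-null : ∀ {ℓ} {P : Poly ℓ} → All (λ t → proj₁ t ≡ 0ℚ) P → ∀ m → coeff P m ≡ 0ℚ
coeff-null All.[] m = refl
coeff-null {P = (c , e) ∷ P} (refl All.∷ zs) m with ≡-dec ℕ._≟_ e m
... | yes _ = trans (ℚₚ.+-identityˡ _) (coeff-null zs m)
... | no  _ = coeff-null zs m

coeff-consExp-same : ∀ {ℓ} e (P : Poly ℓ) m → coeff (map (consExp e) P) (e ∷ m) ≡ coeff P m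
coeff-consExp-same e [] m = refl
coeff-consExp-same e ((c , x) ∷ P) m = byHead (≡-dec ℕ._≟_ x m)
  where
  open ≡-Reasoning
  byHead : Dec (x ≡ m) → coeff (map (consExp e) ((c , x) ∷ P)) (e ∷ m) ≡ coeff ((c , x) ∷ P) m
  byHead (yes x≡m) = begin
    coeff ((c , e ∷ x) ∷ map (consExp e) P) (e ∷ m) ≡⟨ coeff-hit c {e ∷ x} {e ∷ m} _ (cong (e ∷_) x≡m) ⟩
    c + coeff (map (consExp e) P) (e ∷ m)           ≡⟨ cong (λ y → c + y) (coeff-consExp-same e P m) ⟩
    c + coeff P m                                   ≡⟨ coeff-hit c P x≡m ⟨
    coeff ((c , x) ∷ P) m                           ∎
  byHead (no x≢m) = begin
    coeff ((c , e ∷ x) ∷ map (consExp e) P) (e ∷ m) ≡⟨ coeff-miss c {e ∷ x} {e ∷ m} _ (x≢m ∘ ∷-injectiveʳ) ⟩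
    coeff (map (consExp e) P) (e ∷ m)               ≡⟨ coeff-consExp-same e P m ⟩
    coeff P m                                       ≡⟨ coeff-miss c P x≢m ⟨
    coeff ((c , x) ∷ P) m                           ∎

coeff-consExp-other : ∀ {ℓ} {e e′ : ℕ} → ¬ e ≡ e′ → (P : Poly ℓ) (m : Monomial ℓ) →
                      coeff (map (consExp e) P) (e′ ∷ m) ≡ 0ℚ
coeff-consExp-other e≢e′ [] m = refl
coeff-consExp-other {e = e} {e′} e≢e′ ((c , x) ∷ P) m =
  trans (coeff-miss c {e ∷ x} {e′ ∷ m} _ (e≢e′ ∘ ∷-injectiveˡ)) (coeff-consExp-other e≢e′ P m)

-- `affine a b e` is the coefficient of x₁^e in a + x₁·b (a, b free of x₁).
affine : ℚ → ℚ → ℕ → ℚ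
affine a b zero          = a
affine a b (suc zero)    = b
affine a b (suc (suc _)) = 0ℚ

affine-zero : ∀ e → affine 0ℚ 0ℚ e ≡ 0ℚ
affine-zero zero          = refl
affine-zero (suc zero)    = refl
affine-zero (suc (suc _)) = refl

affine-+ : ∀ a b a′ b′ e → affine a b e + affine a′ b′ e ≡ affine (a + a′) (b + b′) e
affine-+ a b a′ b′ zero          = refl
affine-+ a b a′ b′ (suc zero)    = refl
affine-+ a b a′ b′ (suc (suc _)) = refl

affine-− : ∀ a b a′ b′ e → affine a b e - affine a′ b′ e ≡ affine (a - a′) (b - b′) e
affine-− a b a′ b′ zero          = refl
affine-− a b a′ b′ (suc zero)    = refl
affine-− a b a′ b′ (suc (suc _)) = refl

coeff-node : ∀ {ℓ} (P Q : Poly ℓ) e m →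
             coeff (map (consExp 0) P ++ map (consExp 1) Q) (e ∷ m) ≡ affine (coeff P m) (coeff Q m) e
coeff-node P Q e m = trans (coeff-++ (map (consExp 0) P) _ (e ∷ m)) (byExponent e)
  where
  byExponent : ∀ e → coeff (map (consExp 0) P) (e ∷ m) + coeff (map (consExp 1) Q) (e ∷ m)
                     ≡ affine (coeff P m) (coeff Q m) e
  byExponent zero = trans (cong₂ _+_ (coeff-consExp-same 0 P m) (coeff-consExp-other (λ ()) Q m))
                          (ℚₚ.+-identityʳ _)
  byExponent (suc zero) = trans (cong₂ _+_ (coeff-consExp-other (λ ()) P m) (coeff-consExp-same 1 Q m))
                                (ℚₚ.+-identityˡ _)
  byExponent (suc (suc e)) = cong₂ _+_ (coeff-consExp-other (λ ()) P m) (coeff-consExp-other (λ ()) Q m)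

coeff-lower : ∀ {ℓ} (P : Poly ℓ) e m → coeff (map (consExp 0) P) (e ∷ m) ≡ affine (coeff P m) 0ℚ e
coeff-lower P e m =
  trans (cong (λ R → coeff R (e ∷ m)) (sym (Listₚ.++-identityʳ (map (consExp 0) P)))) (coeff-node P [] e m)

-- The value of a + x·c at x := b.
evalAt : Bool → ℚ → ℚ → ℚ
evalAt true  a c = a + c
evalAt false a c = a

-- `resCoeff b p S m` is the coefficient of m in p|_{S ↦ b}, computed on the
-- tree: a variable x₁ ∈ S is substituted (and its exponent must then be 0),
-- a variable x₁ ∉ S is kept.
resCoeff : ∀ {ℓ} → Bool → Multilinear ℓ → Subset ℓ → Monomial ℓ → ℚ
resCoeff b (leaf c)   []            []      = c
resCoeff b (node p q) (inside ∷ S)  (e ∷ m) = affine (evalAt b (resCoeff b p S m) (resCoeff b q S m)) 0ℚ e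
resCoeff b (node p q) (outside ∷ S) (e ∷ m) = affine (resCoeff b p S m) (resCoeff b q S m) e

restrict-consExp : ∀ {ℓ} (S′ : Subset (suc ℓ)) (S : Subset ℓ) b e e′ →
                   (∀ t → restrictTerm S′ b (consExp e t) ≡ consExp e′ (restrictTerm S b t)) →
                   ∀ P → restrict (map (consExp e) P) S′ b ≡ map (consExp e′) (restrict P S b)
restrict-consExp S′ S b e e′ commutes P =
  trans (sym (Listₚ.map-∘ P)) (trans (Listₚ.map-cong commutes P) (Listₚ.map-∘ P))

restrictTerm-outside : ∀ {ℓ} (S : Subset ℓ) b e t →
                       restrictTerm (outside ∷ S) b (consExp e t) ≡ consExp e (restrictTerm S b t)
restrictTerm-outside S true  e (c , m) = refl
restrictTerm-outside S false e (c , m) = refl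

restrict-killed : ∀ {ℓ} (S : Subset ℓ) (P : Poly ℓ) →
                  All (λ t → proj₁ t ≡ 0ℚ) (restrict (map (consExp 1) P) (inside ∷ S) false)
restrict-killed S []            = All.[]
restrict-killed S ((c , m) ∷ P) = refl All.∷ restrict-killed S P

coeff-restrict-inside : ∀ {ℓ} b (P Q : Poly ℓ) S e m →
  coeff (restrict (map (consExp 0) P ++ map (consExp 1) Q) (inside ∷ S) b) (e ∷ m)
  ≡ affine (evalAt b (coeff (restrict P S b) m) (coeff (restrict Q S b) m)) 0ℚ e
coeff-restrict-inside true P Q S e m = begin
  coeff (restrict (map (consExp 0) P ++ map (consExp 1) Q) (inside ∷ S) true) (e ∷ m)
    ≡⟨ cong (λ R → coeff R (e ∷ m)) (trans (Listₚ.map-++ _ (map (consExp 0) P) _)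
         (cong₂ _++_ (restrict-consExp (inside ∷ S) S true 0 0 (λ { (c , x) → refl }) P)
                     (restrict-consExp (inside ∷ S) S true 1 0 (λ { (c , x) → refl }) Q))) ⟩
  coeff (map (consExp 0) (restrict P S true) ++ map (consExp 0) (restrict Q S true)) (e ∷ m)
    ≡⟨ coeff-++ (map (consExp 0) (restrict P S true)) _ (e ∷ m) ⟩
  coeff (map (consExp 0) (restrict P S true)) (e ∷ m) + coeff (map (consExp 0) (restrict Q S true)) (e ∷ m)
    ≡⟨ cong₂ _+_ (coeff-lower (restrict P S true) e m) (coeff-lower (restrict Q S true) e m) ⟩
  affine (coeff (restrict P S true) m) 0ℚ e + affine (coeff (restrict Q S true) m) 0ℚ e
    ≡⟨ affine-+ _ 0ℚ _ 0ℚ e ⟩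
  affine (coeff (restrict P S true) m + coeff (restrict Q S true) m) 0ℚ e ∎
  where open ≡-Reasoning
coeff-restrict-inside false P Q S e m = begin
  coeff (restrict (map (consExp 0) P ++ map (consExp 1) Q) (inside ∷ S) false) (e ∷ m)
    ≡⟨ cong (λ R → coeff R (e ∷ m)) (Listₚ.map-++ _ (map (consExp 0) P) _) ⟩
  coeff (restrict (map (consExp 0) P) (inside ∷ S) false ++ restrict (map (consExp 1) Q) (inside ∷ S) false) (e ∷ m)
    ≡⟨ coeff-++ (restrict (map (consExp 0) P) (inside ∷ S) false) _ (e ∷ m) ⟩
  coeff (restrict (map (consExp 0) P) (inside ∷ S) false) (e ∷ m)
    + coeff (restrict (map (consExp 1) Q) (inside ∷ S) false) (e ∷ m)
    ≡⟨ cong₂ _+_ (cong (λ R → coeff R (e ∷ m)) (restrict-consExp (inside ∷ S) S false 0 0 (λ { (c , x) → refl }) P))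
                 (coeff-null (restrict-killed S Q) (e ∷ m)) ⟩
  coeff (map (consExp 0) (restrict P S false)) (e ∷ m) + 0ℚ
    ≡⟨ ℚₚ.+-identityʳ _ ⟩
  coeff (map (consExp 0) (restrict P S false)) (e ∷ m)
    ≡⟨ coeff-lower (restrict P S false) e m ⟩
  affine (coeff (restrict P S false) m) 0ℚ e ∎
  where open ≡-Reasoning

coeff-restrict-outside : ∀ {ℓ} b (P Q : Poly ℓ) S e m →
  coeff (restrict (map (consExp 0) P ++ map (consExp 1) Q) (outside ∷ S) b) (e ∷ m)
  ≡ affine (coeff (restrict P S b) m) (coeff (restrict Q S b) m) e
coeff-restrict-outside b P Q S e m =
  trans (cong (λ R → coeff R (e ∷ m))
          (trans (Listₚ.map-++ _ (map (consExp 0) P) _)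
                 (cong₂ _++_ (restrict-consExp (outside ∷ S) S b 0 0 (restrictTerm-outside S b 0) P)
                             (restrict-consExp (outside ∷ S) S b 1 1 (restrictTerm-outside S b 1) Q))))
        (coeff-node (restrict P S b) (restrict Q S b) e m)

coeff-restrict : ∀ {ℓ} b (p : Multilinear ℓ) S m → coeff (restrict (terms p) S b) m ≡ resCoeff b p S m
coeff-restrict true  (leaf c) [] [] = ℚₚ.+-identityʳ c
coeff-restrict false (leaf c) [] [] = ℚₚ.+-identityʳ c
coeff-restrict b (node p q) (inside ∷ S) (e ∷ m) =
  trans (coeff-restrict-inside b (terms p) (terms q) S e m)
        (cong (λ x → affine x 0ℚ e) (cong₂ (evalAt b) (coeff-restrict b p S m) (coeff-restrict b q S m)))
coeff-restrict b (node p q) (outside ∷ S) (e ∷ m) =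
  trans (coeff-restrict-outside b (terms p) (terms q) S e m)
        (cong₂ (λ x y → affine x y e) (coeff-restrict b p S m) (coeff-restrict b q S m))

evalAt-− : ∀ b a c a′ c′ → evalAt b (a - a′) (c - c′) ≡ evalAt b a c - evalAt b a′ c′
evalAt-− true  = solve 4 (λ a c a′ c′ → (a :- a′) :+ (c :- c′) := (a :+ c) :- (a′ :+ c′)) refl
evalAt-− false a c a′ c′ = refl

evalAt-zero : ∀ b → evalAt b 0ℚ 0ℚ ≡ 0ℚ
evalAt-zero true  = refl
evalAt-zero false = refl

resCoeff-⊖ : ∀ {ℓ} b (p q : Multilinear ℓ) S m → resCoeff b (p ⊖ q) S m ≡ resCoeff b p S m - resCoeff b q S m
resCoeff-⊖ b (leaf c) (leaf c′) [] [] = refl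
resCoeff-⊖ b (node p₀ p₁) (node q₀ q₁) (inside ∷ S) (e ∷ m) = begin
  affine (evalAt b (resCoeff b (p₀ ⊖ q₀) S m) (resCoeff b (p₁ ⊖ q₁) S m)) 0ℚ e
    ≡⟨ cong (λ x → affine x 0ℚ e)
         (trans (cong₂ (evalAt b) (resCoeff-⊖ b p₀ q₀ S m) (resCoeff-⊖ b p₁ q₁ S m)) (evalAt-− b _ _ _ _)) ⟩
  affine (evalAt b (resCoeff b p₀ S m) (resCoeff b p₁ S m) - evalAt b (resCoeff b q₀ S m) (resCoeff b q₁ S m)) 0ℚ e
    ≡⟨ affine-− _ 0ℚ _ 0ℚ e ⟨
  affine (evalAt b (resCoeff b p₀ S m) (resCoeff b p₁ S m)) 0ℚ e
    - affine (evalAt b (resCoeff b q₀ S m) (resCoeff b q₁ S m)) 0ℚ e ∎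
  where open ≡-Reasoning
resCoeff-⊖ b (node p₀ p₁) (node q₀ q₁) (outside ∷ S) (e ∷ m) =
  trans (cong₂ (λ x y → affine x y e) (resCoeff-⊖ b p₀ q₀ S m) (resCoeff-⊖ b p₁ q₁ S m))
        (sym (affine-− _ _ _ _ e))

resCoeff-zero : ∀ {ℓ} b S m → resCoeff b (zeroML ℓ) S m ≡ 0ℚ
resCoeff-zero b [] [] = refl
resCoeff-zero b (inside ∷ S) (e ∷ m) =
  trans (cong (λ x → affine x 0ℚ e)
          (trans (cong₂ (evalAt b) (resCoeff-zero b S m) (resCoeff-zero b S m)) (evalAt-zero b)))
        (affine-zero e)
resCoeff-zero b (outside ∷ S) (e ∷ m) =
  trans (cong₂ (λ x y → affine x y e) (resCoeff-zero b S m) (resCoeff-zero b S m)) (affine-zero e)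

constCoeff : ∀ {ℓ} → ℚ → Monomial ℓ → ℚ
constCoeff q m = if isZeroMon m then q else 0ℚ

affine-const : ∀ {ℓ} q (m : Monomial ℓ) e → affine (constCoeff q m) 0ℚ e ≡ constCoeff q (e ∷ m)
affine-const q m zero          = refl
affine-const q m (suc zero)    = refl
affine-const q m (suc (suc e)) = refl

threshold-ones : ∀ ℓ k S (m : Monomial ℓ) → k ℕ.≤ # S →
                 resCoeff true (threshold ℓ k) S m ≡ constCoeff 1ℚ m
threshold-ones zero zero    [] [] _  = refl
threshold-ones zero (suc k) [] [] ()
threshold-ones (suc ℓ) zero (inside ∷ S) (e ∷ m) _ = begin
  affine (resCoeff true (threshold ℓ 0) S m + resCoeff true (zeroML ℓ) S m) 0ℚ e
    ≡⟨ cong (λ x → affine x 0ℚ e)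
         (trans (cong₂ _+_ (threshold-ones ℓ 0 S m z≤n) (resCoeff-zero true S m)) (ℚₚ.+-identityʳ _)) ⟩
  affine (constCoeff 1ℚ m) 0ℚ e ≡⟨ affine-const 1ℚ m e ⟩
  constCoeff 1ℚ (e ∷ m)         ∎
  where open ≡-Reasoning
threshold-ones (suc ℓ) (suc k) (inside ∷ S) (e ∷ m) (s≤s k≤|S|) = begin
  affine (a + resCoeff true (threshold ℓ k ⊖ threshold ℓ (suc k)) S m) 0ℚ e
    ≡⟨ cong (λ x → affine (a + x) 0ℚ e) (resCoeff-⊖ true (threshold ℓ k) (threshold ℓ (suc k)) S m) ⟩
  affine (a + (resCoeff true (threshold ℓ k) S m - a)) 0ℚ e
    ≡⟨ cong (λ x → affine x 0ℚ e) (solve 2 (λ a x → a :+ (x :- a) := x) refl a _) ⟩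
  affine (resCoeff true (threshold ℓ k) S m) 0ℚ e
    ≡⟨ cong (λ x → affine x 0ℚ e) (threshold-ones ℓ k S m k≤|S|) ⟩
  affine (constCoeff 1ℚ m) 0ℚ e ≡⟨ affine-const 1ℚ m e ⟩
  constCoeff 1ℚ (e ∷ m)         ∎
  where
  open ≡-Reasoning
  a = resCoeff true (threshold ℓ (suc k)) S m
threshold-ones (suc ℓ) zero (outside ∷ S) (e ∷ m) le =
  trans (cong₂ (λ x y → affine x y e) (threshold-ones ℓ 0 S m le) (resCoeff-zero true S m))
        (affine-const 1ℚ m e)
threshold-ones (suc ℓ) (suc k) (outside ∷ S) (e ∷ m) le = begin
  affine (resCoeff true (threshold ℓ (suc k)) S m)
         (resCoeff true (threshold ℓ k ⊖ threshold ℓ (suc k)) S m) e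
    ≡⟨ cong₂ (λ x y → affine x y e) (threshold-ones ℓ (suc k) S m le)
         (trans (resCoeff-⊖ true (threshold ℓ k) (threshold ℓ (suc k)) S m)
                (cong₂ _-_ (threshold-ones ℓ k S m (ℕₚ.<⇒≤ le)) (threshold-ones ℓ (suc k) S m le))) ⟩
  affine (constCoeff 1ℚ m) (constCoeff 1ℚ m - constCoeff 1ℚ m) e
    ≡⟨ cong (λ y → affine (constCoeff 1ℚ m) y e) (ℚₚ.+-inverseʳ (constCoeff 1ℚ m)) ⟩
  affine (constCoeff 1ℚ m) 0ℚ e ≡⟨ affine-const 1ℚ m e ⟩
  constCoeff 1ℚ (e ∷ m)         ∎
  where open ≡-Reasoning

threshold-zeros : ∀ ℓ k S (m : Monomial ℓ) → ℓ ℕ.< k ℕ.+ # S →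
                  resCoeff false (threshold ℓ k) S m ≡ 0ℚ
threshold-zeros zero zero    [] [] ()
threshold-zeros zero (suc k) [] [] _ = refl
threshold-zeros (suc ℓ) zero (inside ∷ S) (e ∷ m) (s≤s lt) =
  trans (cong (λ x → affine x 0ℚ e) (threshold-zeros ℓ 0 S m lt)) (affine-zero e)
threshold-zeros (suc ℓ) (suc k) (inside ∷ S) (e ∷ m) lt =
  trans (cong (λ x → affine x 0ℚ e) (threshold-zeros ℓ (suc k) S m ℓ<k+1+|S|)) (affine-zero e)
  where
  ℓ<k+1+|S| : ℓ ℕ.< suc k ℕ.+ # S
  ℓ<k+1+|S| = ℕ.s≤s⁻¹ (subst (suc (suc ℓ) ℕ.≤_) (ℕₚ.+-suc (suc k) (# S)) lt)
threshold-zeros (suc ℓ) zero (outside ∷ S) (e ∷ m) lt =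
  trans (cong₂ (λ x y → affine x y e) (threshold-zeros ℓ 0 S m (ℕₚ.<⇒≤ lt)) (resCoeff-zero false S m))
        (affine-zero e)
threshold-zeros (suc ℓ) (suc k) (outside ∷ S) (e ∷ m) lt =
  trans (cong₂ (λ x y → affine x y e) (threshold-zeros ℓ (suc k) S m (ℕₚ.<⇒≤ lt))
          (trans (resCoeff-⊖ false (threshold ℓ k) (threshold ℓ (suc k)) S m)
                 (cong₂ _-_ (threshold-zeros ℓ k S m (ℕ.s≤s⁻¹ lt))
                            (threshold-zeros ℓ (suc k) S m (ℕₚ.<⇒≤ lt)))))
        (affine-zero e)

restrict-threshold-ones : ∀ ℓ k S → k ℕ.≤ # S → IsConstant (restrict (terms (threshold ℓ k)) S true) 1ℚ
restrict-threshold-ones ℓ k S k≤|S| m =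
  trans (coeff-restrict true (threshold ℓ k) S m) (threshold-ones ℓ k S m k≤|S|)

restrict-threshold-zeros : ∀ ℓ k S → ℓ ℕ.< k ℕ.+ # S → IsConstant (restrict (terms (threshold ℓ k)) S false) 0ℚ
restrict-threshold-zeros ℓ k S ℓ<k+|S| m =
  trans (coeff-restrict false (threshold ℓ k) S m)
        (trans (threshold-zeros ℓ k S m ℓ<k+|S|) (sym (if-same (isZeroMon m))))
  where
  if-same : ∀ z → (if z then 0ℚ else 0ℚ) ≡ 0ℚ
  if-same true  = refl
  if-same false = refl

terms-normal : ∀ {ℓ} (p : Multilinear ℓ) → NormalForm (terms p)
terms-normal (leaf c) = All.[] Unique.∷ Unique.[]
terms-normal {suc ℓ} (node p q) = subst Unique.Unique (sym exponents)
  (Uniqueₚ.++⁺ (Uniqueₚ.map⁺ ∷-injectiveʳ (terms-normal p))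
               (Uniqueₚ.map⁺ ∷-injectiveʳ (terms-normal q)) disjoint)
  where
  shift : ∀ e (P : Poly ℓ) → map proj₂ (map (consExp e) P) ≡ map (e ∷_) (map proj₂ P)
  shift e P = trans (sym (Listₚ.map-∘ {g = proj₂} {f = consExp e} P)) (Listₚ.map-∘ {g = e ∷_} {f = proj₂} P)
  exponents : map proj₂ (terms (node p q))
              ≡ map (0 ∷_) (map proj₂ (terms p)) ++ map (1 ∷_) (map proj₂ (terms q))
  exponents = trans (Listₚ.map-++ proj₂ (map (consExp 0) (terms p)) _)
                    (cong₂ _++_ (shift 0 (terms p)) (shift 1 (terms q)))
  disjoint : ∀ {v} → ¬ (v ∈ map (0 ∷_) (map proj₂ (terms p)) × v ∈ map (1 ∷_) (map proj₂ (terms q)))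
  disjoint (i , j) with ∈-map⁻ (0 ∷_) i | ∈-map⁻ (1 ∷_) j
  ... | _ , _ , refl | _ , _ , ()

-- The coefficient of x₁⋯x_ℓ.
leadCoeff : ∀ {ℓ} → Multilinear ℓ → ℚ
leadCoeff (leaf c)   = c
leadCoeff (node p q) = leadCoeff q

leadCoeff-⊖ : ∀ {ℓ} (p q : Multilinear ℓ) → leadCoeff (p ⊖ q) ≡ leadCoeff p - leadCoeff q
leadCoeff-⊖ (leaf a)     (leaf b)     = refl
leadCoeff-⊖ (node p₀ p₁) (node q₀ q₁) = leadCoeff-⊖ p₁ q₁

leadCoeff-zero : ∀ ℓ → leadCoeff (zeroML ℓ) ≡ 0ℚ
leadCoeff-zero zero    = refl
leadCoeff-zero (suc ℓ) = leadCoeff-zero ℓ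

terms-degree≤ : ∀ {ℓ} (p : Multilinear ℓ) → All (λ t → totalDeg (proj₂ t) ℕ.≤ ℓ) (terms p)
terms-degree≤ (leaf c) = z≤n All.∷ All.[]
terms-degree≤ (node p q) = Allₚ.++⁺
  (Allₚ.map⁺ (All.map (λ { {c , m} d → ℕₚ.m≤n⇒m≤1+n d }) (terms-degree≤ p)))
  (Allₚ.map⁺ (All.map (λ { {c , m} d → s≤s d }) (terms-degree≤ q)))

terms-lead : ∀ {ℓ} (p : Multilinear ℓ) → ¬ leadCoeff p ≡ 0ℚ →
             Any (λ t → (¬ proj₁ t ≡ 0ℚ) × totalDeg (proj₂ t) ≡ ℓ) (terms p)
terms-lead (leaf c) c≢0 = Any.here (c≢0 , refl)
terms-lead (node p q) lead≢0 = Anyₚ.++⁺ʳ (map (consExp 0) (terms p))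
  (Anyₚ.map⁺ (Any.map (λ { {c , m} (c≢0 , d) → c≢0 , cong suc d }) (terms-lead q lead≢0)))

terms-hasDegree : ∀ {ℓ} (p : Multilinear ℓ) → ¬ leadCoeff p ≡ 0ℚ → HasDegree (terms p) ℓ
terms-hasDegree p lead≢0 = terms-lead p lead≢0 , All.map (λ d _ → d) (terms-degree≤ p)

Signed : Bool → ℚ → Set
Signed true  x = 1ℚ ≤ x
Signed false x = x ≤ - 1ℚ

WeaklySigned : Bool → ℚ → Set
WeaklySigned true  x = 0ℚ ≤ x
WeaklySigned false x = x ≤ 0ℚ

signed⇒weaklySigned : ∀ s x → Signed s x → WeaklySigned s x
signed⇒weaklySigned true  x 1≤x  = ℚₚ.≤-trans (toWitness {a? = 0ℚ ℚₚ.≤? 1ℚ} tt) 1≤x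
signed⇒weaklySigned false x x≤-1 = ℚₚ.≤-trans x≤-1 (toWitness {a? = - 1ℚ ℚₚ.≤? 0ℚ} tt)

zero-weaklySigned : ∀ s → WeaklySigned s 0ℚ
zero-weaklySigned true  = ℚₚ.≤-refl
zero-weaklySigned false = ℚₚ.≤-refl

signed-− : ∀ s x y → WeaklySigned (not s) x → Signed s y → Signed (not s) (x - y)
signed-− true  x y x≤0 1≤y = ℚₚ.+-mono-≤ x≤0 (ℚₚ.neg-antimono-≤ 1≤y)
signed-− false x y 0≤x y≤-1 = ℚₚ.+-mono-≤ 0≤x (ℚₚ.neg-antimono-≤ y≤-1)

signed≢0 : ∀ s x → Signed s x → ¬ x ≡ 0ℚ
signed≢0 true  x 1≤x  refl = toWitnessFalse {a? = 1ℚ ℚₚ.≤? 0ℚ} tt 1≤x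
signed≢0 false x x≤-1 refl = toWitnessFalse {a? = 0ℚ ℚₚ.≤? - 1ℚ} tt x≤-1

-- The sign (−1)^d, as a Boolean.
isEven : ℕ → Bool
isEven zero    = true
isEven (suc n) = not (isEven n)

leadCoeff-threshold-step : ∀ ℓ k →
  leadCoeff (threshold (suc ℓ) (suc k)) ≡ leadCoeff (threshold ℓ k) - leadCoeff (threshold ℓ (suc k))
leadCoeff-threshold-step ℓ k = leadCoeff-⊖ (threshold ℓ k) (threshold ℓ (suc k))

leadCoeff-threshold-vanish : ∀ ℓ j → ℓ ℕ.≤ j → leadCoeff (threshold ℓ (suc j)) ≡ 0ℚ
leadCoeff-threshold-vanish zero j _ = refl
leadCoeff-threshold-vanish (suc ℓ) (suc j) (s≤s ℓ≤j) =
  trans (leadCoeff-threshold-step ℓ (suc j))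
        (cong₂ _-_ (leadCoeff-threshold-vanish ℓ j ℓ≤j)
                   (leadCoeff-threshold-vanish ℓ (suc j) (ℕₚ.m≤n⇒m≤1+n ℓ≤j)))

-- For 1 ≤ k ≤ ℓ the leading coefficient of Thr(ℓ,k) has sign (−1)^(ℓ−k)
-- and modulus at least 1 (it equals (−1)^(ℓ−k)·C(ℓ−1,k−1)).
leadCoeff-threshold-signed : ∀ j d → Signed (isEven d) (leadCoeff (threshold (suc j ℕ.+ d) (suc j)))
leadCoeff-threshold-signed zero zero = ℚₚ.≤-refl
leadCoeff-threshold-signed zero (suc d) =
  subst (Signed (not (isEven d)))
    (sym (trans (leadCoeff-threshold-step (suc d) 0)
                (cong (_- leadCoeff (threshold (suc d) 1)) (leadCoeff-zero d))))
    (signed-− (isEven d) 0ℚ _ (zero-weaklySigned _) (leadCoeff-threshold-signed zero d))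
leadCoeff-threshold-signed (suc j) zero =
  subst (Signed true) (sym lastStep) (leadCoeff-threshold-signed j zero)
  where
  ℓ : ℕ
  ℓ = suc j ℕ.+ 0
  lastStep : leadCoeff (threshold (suc ℓ) (suc (suc j))) ≡ leadCoeff (threshold ℓ (suc j))
  lastStep = trans (leadCoeff-threshold-step ℓ (suc j))
    (trans (cong (λ x → leadCoeff (threshold ℓ (suc j)) - x)
                 (leadCoeff-threshold-vanish ℓ (suc j) (ℕₚ.≤-reflexive (ℕₚ.+-identityʳ (suc j)))))
           (ℚₚ.+-identityʳ _))
leadCoeff-threshold-signed (suc j) (suc d) =
  subst (Signed (not (isEven d))) (sym (leadCoeff-threshold-step (suc j ℕ.+ suc d) (suc j)))
    (signed-− (isEven d) _ _
      (signed⇒weaklySigned _ _ (leadCoeff-threshold-signed j (suc d)))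
      (subst (λ ℓ → Signed (isEven d) (leadCoeff (threshold (suc ℓ) (suc (suc j)))))
             (sym (ℕₚ.+-suc j d)) (leadCoeff-threshold-signed (suc j) d)))

ι : ℕ → ℚ
ι n = + n / 1

ι-+ : ∀ m n → ι (m ℕ.+ n) ≡ ι m + ι n
ι-+ m n = sym (begin
  ι m + ι n                                        ≡⟨ cong₂ _+_ (asFraction m) (asFraction n) ⟩
  (+ m ℤ.* + 1 ℤ.+ + n ℤ.* + 1) / 1                 ≡⟨ cong (_/ 1) (cong₂ ℤ._+_ (ℤₚ.*-identityʳ (+ m)) (ℤₚ.*-identityʳ (+ n))) ⟩
  ι (m ℕ.+ n)                                      ∎)
  where
  open ≡-Reasoning
  asFraction : ∀ n → ι n ≡ ℚ.mkℚ (+ n) 0 (ℕ-Coprime.sym (ℕ-Coprime.1-coprimeTo n))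
  asFraction n = ℚₚ.normalize-coprime {n} {0} _

ι-nonneg : ∀ n → 0ℚ ≤ ι n
ι-nonneg n = ℚₚ.nonNegative⁻¹ (ι n) {{ℚₚ.normalize-nonNeg n 1}}

ι-4* : ∀ n → ι (4 * n) ≡ ι n + (ι n + (ι n + ι n))
ι-4* n = begin
  ι (n ℕ.+ (n ℕ.+ (n ℕ.+ (n ℕ.+ 0))))      ≡⟨ cong (λ z → ι (n ℕ.+ (n ℕ.+ (n ℕ.+ z)))) (ℕₚ.+-identityʳ n) ⟩
  ι (n ℕ.+ (n ℕ.+ (n ℕ.+ n)))              ≡⟨ ι-+ n _ ⟩
  ι n + ι (n ℕ.+ (n ℕ.+ n))                ≡⟨ cong (λ z → ι n + z) (ι-+ n _) ⟩
  ι n + (ι n + ι (n ℕ.+ n))                ≡⟨ cong (λ z → ι n + (ι n + z)) (ι-+ n n) ⟩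
  ι n + (ι n + (ι n + ι n))                ∎
  where open ≡-Reasoning

≤-+-nonneg : ∀ {x} y → 0ℚ ≤ x → y ≤ x + y
≤-+-nonneg {x} y 0≤x = subst (_≤ x + y) (ℚₚ.+-identityˡ y) (ℚₚ.+-monoˡ-≤ y 0≤x)

weight-++ : ∀ {ℓ} (P Q : Poly ℓ) → weight (P ++ Q) ≡ weight P + weight Q
weight-++ []            Q = sym (ℚₚ.+-identityˡ _)
weight-++ ((c , m) ∷ P) Q = trans (cong (λ x → ∣ c ∣ + x) (weight-++ P Q)) (sym (ℚₚ.+-assoc ∣ c ∣ _ _))

weight-consExp : ∀ {ℓ} e (P : Poly ℓ) → weight (map (consExp e) P) ≡ weight P
weight-consExp e []            = refl
weight-consExp e ((c , m) ∷ P) = cong (λ x → ∣ c ∣ + x) (weight-consExp e P)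

weight-node : ∀ {ℓ} (p q : Multilinear ℓ) → weight (terms (node p q)) ≡ weight (terms p) + weight (terms q)
weight-node p q = trans (weight-++ (map (consExp 0) (terms p)) _)
                        (cong₂ _+_ (weight-consExp 0 (terms p)) (weight-consExp 1 (terms q)))

weight-zero : ∀ ℓ → weight (terms (zeroML ℓ)) ≡ 0ℚ
weight-zero zero    = refl
weight-zero (suc ℓ) = trans (weight-node (zeroML ℓ) (zeroML ℓ)) (cong₂ _+_ (weight-zero ℓ) (weight-zero ℓ))

+-interchange : ∀ a b c d → (a + b) + (c + d) ≡ (a + c) + (b + d)
+-interchange = solve 4 (λ a b c d → (a :+ b) :+ (c :+ d) := (a :+ c) :+ (b :+ d)) refl

weight-⊖ : ∀ {ℓ} (p q : Multilinear ℓ) → weight (terms (p ⊖ q)) ≤ weight (terms p) + weight (terms q)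
weight-⊖ (leaf a) (leaf b) =
  subst₂ _≤_ (sym (ℚₚ.+-identityʳ _)) (sym (cong₂ _+_ (ℚₚ.+-identityʳ ∣ a ∣) (ℚₚ.+-identityʳ ∣ b ∣)))
         (ℚₚ.∣p-q∣≤∣p∣+∣q∣ a b)
weight-⊖ (node p₀ p₁) (node q₀ q₁) = begin
  weight (terms (node (p₀ ⊖ q₀) (p₁ ⊖ q₁)))                  ≡⟨ weight-node (p₀ ⊖ q₀) (p₁ ⊖ q₁) ⟩
  weight (terms (p₀ ⊖ q₀)) + weight (terms (p₁ ⊖ q₁))        ≤⟨ ℚₚ.+-mono-≤ (weight-⊖ p₀ q₀) (weight-⊖ p₁ q₁) ⟩
  (weight (terms p₀) + weight (terms q₀)) + (weight (terms p₁) + weight (terms q₁))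
    ≡⟨ +-interchange (weight (terms p₀)) (weight (terms q₀)) (weight (terms p₁)) (weight (terms q₁)) ⟩
  (weight (terms p₀) + weight (terms p₁)) + (weight (terms q₀) + weight (terms q₁))
    ≡⟨ cong₂ _+_ (weight-node p₀ p₁) (weight-node q₀ q₁) ⟨
  weight (terms (node p₀ p₁)) + weight (terms (node q₀ q₁))   ∎
  where open ℚₚ.≤-Reasoning

-- Each variable at most triples the weight of a threshold polynomial, so
-- w(Thr(ℓ,k)) ≤ 4^ℓ.
weight-threshold : ∀ ℓ k → weight (terms (threshold ℓ k)) ≤ ι (4 ^ ℓ)
weight-threshold zero zero    = ℚₚ.≤-refl
weight-threshold zero (suc k) = toWitness {a? = weight (terms (threshold 0 1)) ℚₚ.≤? 1ℚ} tt
weight-threshold (suc ℓ) k = begin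
  weight (terms (threshold (suc ℓ) k)) ≤⟨ step k ⟩
  x + (x + x)                          ≤⟨ ℚₚ.+-monoʳ-≤ x (ℚₚ.+-monoʳ-≤ x (grow x)) ⟩
  x + (x + (x + x))                    ≡⟨ ι-4* (4 ^ ℓ) ⟨
  ι (4 ^ suc ℓ)                        ∎
  where
  open ℚₚ.≤-Reasoning
  x : ℚ
  x = ι (4 ^ ℓ)
  grow : ∀ y → y ≤ x + y
  grow y = ≤-+-nonneg y (ι-nonneg (4 ^ ℓ))
  step : ∀ k → weight (terms (threshold (suc ℓ) k)) ≤ x + (x + x)
  step zero = begin
    weight (terms (threshold (suc ℓ) 0))                      ≡⟨ weight-node (threshold ℓ 0) (zeroML ℓ) ⟩
    weight (terms (threshold ℓ 0)) + weight (terms (zeroML ℓ)) ≡⟨ cong (λ z → weight (terms (threshold ℓ 0)) + z) (weight-zero ℓ) ⟩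
    weight (terms (threshold ℓ 0)) + 0ℚ                        ≡⟨ ℚₚ.+-identityʳ _ ⟩
    weight (terms (threshold ℓ 0))                             ≤⟨ weight-threshold ℓ 0 ⟩
    x                                                          ≤⟨ grow x ⟩
    x + x                                                      ≤⟨ grow (x + x) ⟩
    x + (x + x)                                                ∎
  step (suc k) = begin
    weight (terms (threshold (suc ℓ) (suc k)))
      ≡⟨ weight-node (threshold ℓ (suc k)) (threshold ℓ k ⊖ threshold ℓ (suc k)) ⟩
    weight (terms (threshold ℓ (suc k))) + weight (terms (threshold ℓ k ⊖ threshold ℓ (suc k)))
      ≤⟨ ℚₚ.+-mono-≤ (weight-threshold ℓ (suc k)) (weight-⊖ (threshold ℓ k) (threshold ℓ (suc k))) ⟩
    x + (weight (terms (threshold ℓ k)) + weight (terms (threshold ℓ (suc k))))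
      ≤⟨ ℚₚ.+-monoʳ-≤ x (ℚₚ.+-mono-≤ (weight-threshold ℓ k) (weight-threshold ℓ (suc k))) ⟩
    x + (x + x) ∎

majority : ∀ ℓ → Multilinear ℓ
majority ℓ = threshold ℓ ⌈ ℓ /2⌉

/2≡⌊/2⌋ : ∀ ℓ → ℓ ℕ./ 2 ≡ ⌊ ℓ /2⌋
/2≡⌊/2⌋ zero          = refl
/2≡⌊/2⌋ (suc zero)    = refl
/2≡⌊/2⌋ (suc (suc ℓ)) = trans (ℕ-DivMod.m/n≡1+[m∸n]/n {suc (suc ℓ)} {2} (s≤s (s≤s z≤n))) (cong suc (/2≡⌊/2⌋ ℓ))

-- With r = ⌊ℓ/2⌋+1 we have ⌈ℓ/2⌉ ≤ r and ℓ − ⌈ℓ/2⌉ < r.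
majority-pseudoMajority : ∀ ℓ → PseudoMajority ℓ (terms (majority ℓ))
majority-pseudoMajority ℓ S |S|≡r = byValue
  where
  |S|≡1+⌊ℓ/2⌋ : # S ≡ suc ⌊ ℓ /2⌋
  |S|≡1+⌊ℓ/2⌋ = trans |S|≡r (cong suc (/2≡⌊/2⌋ ℓ))
  ⌈ℓ/2⌉≤1+⌊ℓ/2⌋ : ⌈ ℓ /2⌉ ℕ.≤ suc ⌊ ℓ /2⌋
  ⌈ℓ/2⌉≤1+⌊ℓ/2⌋ = ℕₚ.⌊n/2⌋-mono (ℕₚ.n≤1+n (suc ℓ))
  ℓ<⌈ℓ/2⌉+1+⌊ℓ/2⌋ : ℓ ℕ.< ⌈ ℓ /2⌉ ℕ.+ suc ⌊ ℓ /2⌋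
  ℓ<⌈ℓ/2⌉+1+⌊ℓ/2⌋ = subst (ℓ ℕ.<_) (sym (ℕₚ.+-suc ⌈ ℓ /2⌉ ⌊ ℓ /2⌋))
    (s≤s (ℕₚ.≤-reflexive (sym (trans (ℕₚ.+-comm ⌈ ℓ /2⌉ ⌊ ℓ /2⌋) (ℕₚ.⌊n/2⌋+⌈n/2⌉≡n ℓ)))))
  byValue : ∀ b → IsConstant (restrict (terms (majority ℓ)) S b) (boolℚ b)
  byValue true  = restrict-threshold-ones ℓ ⌈ ℓ /2⌉ S
    (subst (⌈ ℓ /2⌉ ℕ.≤_) (sym |S|≡1+⌊ℓ/2⌋) ⌈ℓ/2⌉≤1+⌊ℓ/2⌋)
  byValue false = restrict-threshold-zeros ℓ ⌈ ℓ /2⌉ S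
    (subst (λ r → ℓ ℕ.< ⌈ ℓ /2⌉ ℕ.+ r) (sym |S|≡1+⌊ℓ/2⌋) ℓ<⌈ℓ/2⌉+1+⌊ℓ/2⌋)

-- The majority polynomial has degree exactly ℓ: for ℓ = n+1 its threshold is
-- ⌊n/2⌋+1 ≥ 1 and ℓ = (⌊n/2⌋+1) + ⌈n/2⌉.
majority-leadCoeff≢0 : ∀ ℓ → ¬ leadCoeff (majority ℓ) ≡ 0ℚ
majority-leadCoeff≢0 zero    = signed≢0 true 1ℚ ℚₚ.≤-refl
majority-leadCoeff≢0 (suc n) =
  subst (λ ℓ → ¬ leadCoeff (threshold ℓ (suc ⌊ n /2⌋)) ≡ 0ℚ) (cong suc (ℕₚ.⌊n/2⌋+⌈n/2⌉≡n n))
    (signed≢0 _ _ (leadCoeff-threshold-signed ⌊ n /2⌋ ⌈ n /2⌉))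

-- Thr(ℓ,⌈ℓ/2⌉) is an ℓ-pseudo-majority of degree ℓ and weight ≤ 4^ℓ = 1·2^(2ℓ).
corollary2p5 : ∃ λ (c : ℕ) → ∃ λ (C : ℕ) → (ℓ : ℕ) →
    Σ (Poly ℓ) λ P → NormalForm P × PseudoMajority ℓ P × HasDegree P ℓ ×
    (weight P ≤ (+ (c * 2 ^ (C * ℓ))) / 1)
corollary2p5 = 1 , 2 , λ ℓ →
  terms (majority ℓ) ,
  terms-normal (majority ℓ) ,
  majority-pseudoMajority ℓ ,
  terms-hasDegree (majority ℓ) (majority-leadCoeff≢0 ℓ) ,
  subst (λ n → weight (terms (majority ℓ)) ≤ (+ n) / 1) (4^ℓ≡1*2^[2ℓ] ℓ) (weight-threshold ℓ ⌈ ℓ /2⌉)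
  where
  4^ℓ≡1*2^[2ℓ] : ∀ ℓ → 4 ^ ℓ ≡ 1 * 2 ^ (2 * ℓ)
  4^ℓ≡1*2^[2ℓ] ℓ = trans (ℕₚ.^-*-assoc 2 2 ℓ) (sym (ℕₚ.*-identityˡ _))
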